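{- Let $\mathscr S=\langle E,S,F,N,g,s\rangle$ be an abstract formal system and let $T\subseteq S$ be arbitrary. Then the set $\{n\in N : g^{ -1}(n)[n]\notin T\}$ is not $T$-representable in $\mathscr S$.
   Context: An abstract formal system is a tuple $\mathscr S=\langle E,S,F,N,g,s\rangle$ such that: (i) $\emptyset\neq S\subseteq F\subseteq E$ and $N$ is a set with $F\cap N=\emptyset$ ($E$ = expressions, $F$ = formulas, $S$ = sentences, $N$ = names); (ii) $g$ is a one-one map from $F$ onto $N$ (the naming function), with inverse $g^{ -1}$; (iii) $s$ is a map from $F\times N$ into $S$ such that $s(\sigma,n)=\sigma$ for all $\sigma\in S$, $n\in N$; one writes $\varphi[n]$ for $s(\varphi,n)$. For $A\subseteq S$ and $X\subseteq N$, $X$ is called $A$-representable (in $\mathscr S$) if there is $\varphi\in F$ such that for every $n\in N$: $\varphi[n]\in A$ iff $n\in X$. -}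

module Defs where

open import Level using (Level; _⊔_; suc)
open import Data.Product using (Σ; ∃; _,_; proj₁; proj₂)
open import Relation.Unary using (Pred; _⊆_; _∈_; _∉_)
open import Relation.Binary.PropositionalEquality using (_≡_)
open import Function.Bundles using (_↔_; Inverse; _⇔_)

-- An abstract formal system ⟨E,S,F,N,g,s⟩.
-- E is a type of expressions; F and S are subsets of E (predicates);
-- N is a separate type of names (hence F ∩ N = ∅ automatically).
record AbstractFormalSystem (a ℓ : Level) : Set (suc (a ⊔ ℓ)) where
  field
    E     : Set a
    isF   : Pred E ℓ
    isS   : Pred E ℓ
    N     : Set a
    S⊆F   : isS ⊆ isF
    S≠∅   : ∃ λ e → e ∈ isS

  Formula : Set (a ⊔ ℓ)
  Formula = Σ E isF

  field
    g : Formula ↔ N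
    s : Formula → N → E
    s-sentence : ∀ φ n → s φ n ∈ isS
    s-fixes-sentences : ∀ σ (σS : σ ∈ isS) n → s (σ , S⊆F σS) n ≡ σ

  name : Formula → N
  name = Inverse.to g

  g⁻¹ : N → Formula
  g⁻¹ = Inverse.from g

  _[_] : Formula → N → E
  φ [ n ] = s φ n

  Representable : ∀ {p q} → Pred E p → Pred N q → Set (a ⊔ ℓ ⊔ p ⊔ q)
  Representable A X = Σ Formula λ φ → ∀ n → (φ [ n ] ∈ A) ⇔ (n ∈ X)

  diagComplement : ∀ {p} → Pred E p → Pred N p
  diagComplement T n = (g⁻¹ n) [ n ] ∉ T

module Submission where

open import Defs
open import Relation.Unary using (Pred; _⊆_)
open import Relation.Nullary using (¬_)
open import Data.Product using (_,_)
open import Function.Bundles using (Inverse; Equivalence; _⇔_)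
open import Relation.Binary.PropositionalEquality using (_≡_; cong; subst)

-- Cantor's diagonal argument: if φ represented the diagonal complement, then
-- at φ's own name n we would have g⁻¹(n) = φ, so φ[n] ∈ T iff φ[n] ∉ T.

¬[P⇔¬P] : ∀ {p} {P : Set p} → ¬ (P ⇔ (¬ P))
¬[P⇔¬P] P⇔¬P = ¬p p
  where
  open Equivalence P⇔¬P
  ¬p : ¬ _
  ¬p q = to q q
  p = from ¬p

module _ {a ℓ} (𝒮 : AbstractFormalSystem a ℓ) where
  open AbstractFormalSystem 𝒮

  g⁻¹∘name : ∀ φ → g⁻¹ (name φ) ≡ φ
  g⁻¹∘name = Inverse.strictlyInverseʳ g

  diagComplement-name : ∀ {p} (T : Pred E p) φ →
    diagComplement T (name φ) ≡ (¬ T (φ [ name φ ]))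
  diagComplement-name T φ = cong (λ ψ → ¬ T (ψ [ name φ ])) (g⁻¹∘name φ)

mainTheorem1 : ∀ {a ℓ p} (𝒮 : AbstractFormalSystem a ℓ) →
    let open AbstractFormalSystem 𝒮 in
    (T : Pred E p) → T ⊆ isS →
    ¬ Representable T (diagComplement T)
mainTheorem1 𝒮 T _ (φ , represents) =
  ¬[P⇔¬P] (subst (T (φ [ n ]) ⇔_) (diagComplement-name 𝒮 T φ) (represents n))
  where
  open AbstractFormalSystem 𝒮
  n : N
  n = name φ
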